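{- Let $k\in\{4,5,6,7\}$ and $n\geq0$. Let $C_1,C_2$ be chains of $H_k^{\nabla(2^n-1)}$ and $D_1,D_2$ chains of $H_k$, and put $C=C_1^{\nabla2}\mathbin{\nabla}D_1$ and $C'=C_2^{\nabla2}\mathbin{\nabla}D_2$. If $C_1\neq C_2$ or $D_1\neq D_2$, then $C\cap(2^iC')=\varnothing$ and $C'\cap(2^iC)=\varnothing$ for $i=0$ and $i=1$.
   Context: For nonempty finite sets $C=\{c_1,\ldots,c_s\}$, $D$ of positive integers, $C\mathbin{\nabla}D=c_1D\mathbin{\triangle}\cdots\mathbin{\triangle}c_sD$ with $c_iD=\{c_id:d\in D\}$ and $\triangle$ the symmetric difference (equivalently, the set of $m$ for which the number of pairs $(c,d)\in C\times D$ with $cd=m$ is odd); $C\mathbin{\nabla}D=\varnothing$ if $C$ or $D$ is empty. Also $C^{\nabla2}=C\mathbin{\nabla}C$, $aC=\{ac:c\in C\}$. Let $H_k=\{1,\ldots,k\}$, $H_k^{\nabla0}=\{1\}$, $H_k^{\nabla m}=H_k^{\nabla(m-1)}\mathbin{\nabla}H_k$ for $m\geq1$. For a finite set $T$ of positive integers, its chains are: the chains of type A, i.e. the maximal subsets of $T$ of the form $\{x,2x,4x,\ldots,2^{\ell-1}x\}$ with $\ell\geq2$ (not properly contained in another such subset of $T$); and, for each element $z$ of $T$ not lying in any type A chain, the singleton $\{z\}$ (a chain of type C). The chains of $H_k^{\nabla(2^n-1)}$ and of $H_k$ are understood in this sense (e.g. the chains of $H_4$ are $\{1,2,4\}$ and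 $\{3\}$). -}

module Defs where

open import Data.Nat using (ℕ; zero; suc; _+_; _*_; _^_; _≤_; _≟_)
open import Data.Nat.Properties using ()
open import Data.Bool using (Bool; true; false; if_then_else_)
open import Data.List using (List; []; _∷_; map; concatMap; filter; length; upTo; deduplicate)
open import Data.List.Membership.Propositional using (_∈_)
open import Data.Product using (_×_; Σ; ∃; _,_)
open import Data.Sum using (_⊎_)
open import Data.Empty using (⊥)
open import Relation.Nullary using (¬_; Dec; yes; no)
open import Relation.Nullary.Decidable using (⌊_⌋)
open import Relation.Binary.PropositionalEquality using (_≡_)
open import Function using (_∘_)

-- Finite sets of positive integers are represented by lists of naturals,
-- read as sets via membership (order and repetition are irrelevant).

_≃ˢ_ : List ℕ → List ℕ → Set
A ≃ˢ B = ∀ x → (x ∈ A → x ∈ B) × (x ∈ B → x ∈ A)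

_⊆ˢ_ : List ℕ → List ℕ → Set
A ⊆ˢ B = ∀ x → x ∈ A → x ∈ B

scale : ℕ → List ℕ → List ℕ
scale a C = map (a *_) C

isOdd : ℕ → Bool
isOdd zero = false
isOdd (suc zero) = true
isOdd (suc (suc n)) = isOdd n

products : List ℕ → List ℕ → List ℕ
products C D = concatMap (λ c → map (c *_) D) C

pairCount : List ℕ → List ℕ → ℕ → ℕ
pairCount C D m = length (filter (λ p → p ≟ m) (products C D))

-- C ∇ D = { m : the number of pairs (c,d) ∈ C × D with c d = m is odd }
-- (inputs are deduplicated first so that the list representation is
-- read as a set; empty input gives empty output)
_∇_ : List ℕ → List ℕ → List ℕ
C ∇ D = deduplicate _≟_
          (filter (λ m → isOdd (pairCount C' D' m) Data.Bool.≟ true)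
                  (products C' D'))
  where
    C' = deduplicate _≟_ C
    D' = deduplicate _≟_ D

sq∇ : List ℕ → List ℕ
sq∇ C = C ∇ C

H : ℕ → List ℕ
H k = map suc (upTo k)

Hpow : ℕ → ℕ → List ℕ
Hpow k zero = 1 ∷ []
Hpow k (suc m) = Hpow k m ∇ H k

geo : ℕ → ℕ → List ℕ
geo x ℓ = map (λ i → 2 ^ i * x) (upTo ℓ)

IsGeoSubset : List ℕ → List ℕ → Set
IsGeoSubset T X = Σ ℕ λ x → Σ ℕ λ ℓ → (2 ≤ ℓ) × (X ≃ˢ geo x ℓ) × (X ⊆ˢ T)

IsChainA : List ℕ → List ℕ → Set
IsChainA T X = IsGeoSubset T X
             × (∀ Y → IsGeoSubset T Y → X ⊆ˢ Y → Y ⊆ˢ X)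

IsChainC : List ℕ → List ℕ → Set
IsChainC T X = Σ ℕ λ z → (X ≃ˢ (z ∷ [])) × (z ∈ T)
             × (∀ Y → IsChainA T Y → ¬ (z ∈ Y))

IsChain : List ℕ → List ℕ → Set
IsChain T X = IsChainA T X ⊎ IsChainC T X

Disjoint : List ℕ → List ℕ → Set
Disjoint A B = ∀ m → m ∈ A → m ∈ B → ⊥

-- Every chain X of a set T of positive integers, of type A or C alike, is {2^a w, …, 2^b w}
-- for an odd w and a maximal run [a, b] of exponents e with 2^e w ∈ T; two different
-- chains with the same w therefore have runs at least two apart. An element of C₁^{∇2} ∇ D₁
-- is a product 2^t w₁² u₁ with 2a₁ ≤ t ≤ 2b₁ + 2, since for k ≤ 7 the chain D₁ of H_k is
-- {u₁, …, 2^b u₁} with b ≤ 2 and u₁ ∈ {1, 3, 5, 7}. As u₁ is squarefree,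
-- 2^t w₁² u₁ = 2^(t'+i) w₂² u₂ forces t = t' + i, w₁ = w₂ and u₁ = u₂. Then D₁ ≠ D₂ is
-- impossible because chains of H_k start at exponent 0, and C₁ ≠ C₂ puts the exponent
-- ranges [2a, 2b + 2] of the two products two apart, too far for a shift by i ≤ 1.

module Submission where

open import Defs
open import Data.Nat
open import Data.Nat.Properties
open import Data.Nat.Divisibility using (_∣_; _∤_; divides; >⇒∤)
open import Data.Nat.Primality using (Prime; prime?; prime⇒nonZero; prime⇒nonTrivial; euclidsLemma)
open import Data.Nat.Induction using (<-rec)
open import Data.Nat.ListAction using (sum)
open import Data.Nat.Tactic.RingSolver using (solve-∀)
open import Data.List using (List; []; _∷_; map; deduplicate)
open import Data.List.Membership.Propositional using (_∈_; find)
open import Data.List.Membership.Propositional.Properties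
  using (∈-map⁺; ∈-map⁻; ∈-upTo⁺; ∈-upTo⁻; ∈-filter⁻; ∈-deduplicate⁻; ∈-concatMap⁻)
open import Data.List.Membership.DecPropositional _≟_ using (_∈?_)
open import Data.List.Relation.Unary.Any using (here; there)
open import Data.Product using (_×_; _,_; proj₁; proj₂; ∃-syntax; ∃₂)
open import Data.Sum using (_⊎_; inj₁; inj₂; [_,_]′; reduce) renaming (map to ⊎-map)
open import Data.Empty using (⊥; ⊥-elim)
open import Function using (_∘_)
open import Relation.Nullary using (¬_; yes; no; contradiction)
open import Relation.Nullary.Decidable using (from-yes)
open import Relation.Unary using (Decidable)
open import Relation.Binary.Definitions using (tri<; tri≈; tri>)
open import Relation.Binary.PropositionalEquality

private variable
  a a' b b' c d e i j k m n u u' w w' x y ℓ B : ℕ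
  T X Y : List ℕ

Odd : ℕ → Set
Odd n = ∃[ q ] n ≡ suc (2 * q)

Odd⇒>0 : Odd n → 0 < n
Odd⇒>0 (_ , refl) = z<s

Odd⇒≢0 : Odd n → n ≢ 0
Odd⇒≢0 (_ , refl) ()

Odd-* : Odd m → Odd n → Odd (m * n)
Odd-* (p , refl) (q , refl) = p + q + 2 * (p * q) , product p q
  where
  product : ∀ p q → suc (2 * p) * suc (2 * q) ≡ suc (2 * (p + q + 2 * (p * q)))
  product = solve-∀

even⊎odd : ∀ n → (∃[ q ] n ≡ 2 * q) ⊎ Odd n
even⊎odd zero = inj₁ (0 , refl)
even⊎odd (suc n) with even⊎odd n
... | inj₁ (q , refl) = inj₂ (q , refl)
... | inj₂ (q , refl) = inj₁ (suc q , cong suc (sym (+-suc q (q + 0))))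

2^*odd-decomposition : ∀ n → 0 < n → ∃₂ λ e w → Odd w × n ≡ 2 ^ e * w
2^*odd-decomposition = <-rec _ step
  where
  step : ∀ n → (∀ {m} → m < n → 0 < m → ∃₂ λ e w → Odd w × m ≡ 2 ^ e * w)
       → 0 < n → ∃₂ λ e w → Odd w × n ≡ 2 ^ e * w
  step n rec n>0 with even⊎odd n
  ... | inj₂ odd = 0 , n , odd , sym (*-identityˡ n)
  step .(2 * zero) rec () | inj₁ (zero , refl)
  step .(2 * suc q) rec _ | inj₁ (suc q , refl)
    with e , w , odd , q≡ ← rec (m<m+n (suc q) z<s) z<s
       = suc e , w , odd , trans (cong (2 *_) q≡) (sym (*-assoc 2 (2 ^ e) w))

2^*odd-injective : ∀ e e' {w w'} → Odd w → Odd w' → 2 ^ e * w ≡ 2 ^ e' * w' → e ≡ e' × w ≡ w'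
2^*odd-injective zero zero {w} {w'} _ _ eq = refl , trans (sym (*-identityˡ w)) (trans eq (*-identityˡ w'))
2^*odd-injective zero (suc e') {w} {w'} (q , refl) _ eq =
  ⊥-elim (even≢odd (2 ^ e' * w') q (trans (sym (*-assoc 2 (2 ^ e') w')) (trans (sym eq) (*-identityˡ _))))
2^*odd-injective (suc e) zero {w} _ (q , refl) eq =
  ⊥-elim (even≢odd (2 ^ e * w) q (trans (sym (*-assoc 2 (2 ^ e) w)) (trans eq (*-identityˡ _))))
2^*odd-injective (suc e) (suc e') {w} {w'} odd odd' eq
  with refl , refl ← 2^*odd-injective e e' odd odd'
         (*-cancelˡ-≡ _ _ 2 (trans (sym (*-assoc 2 (2 ^ e) w)) (trans eq (*-assoc 2 (2 ^ e') w'))))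
     = refl , refl

m*m≡n*n⇒m≡n : m * m ≡ n * n → m ≡ n
m*m≡n*n⇒m≡n {m} {n} eq with <-cmp m n
... | tri< m<n _ _ = ⊥-elim (<-irrefl eq (*-mono-< m<n m<n))
... | tri≈ _ m≡n _ = m≡n
... | tri> _ _ n<m = ⊥-elim (<-irrefl (sym eq) (*-mono-< n<m n<m))

prime∣x*x⇒prime∣x : ∀ {p} x → Prime p → p ∣ x * x → p ∣ x
prime∣x*x⇒prime∣x x pp p∣x*x = reduce (euclidsLemma x x pp p∣x*x)

-- Infinite descent: p divides y, hence x, and then x/p, y/p solve the same equation.
x*x*p≡y*y*v⇒x≡0 : ∀ {p v} → Prime p → p ∤ v → ∀ x y → x * x * p ≡ y * y * v → x ≡ 0
x*x*p≡y*y*v⇒x≡0 {p} {v} pp p∤v = <-rec _ descend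
  where
  instance
    p≢0 : NonZero p
    p≢0 = prime⇒nonZero pp

  p∣y : ∀ x y → x * x * p ≡ y * y * v → p ∣ y
  p∣y x y eq with euclidsLemma (y * y) v pp (divides (x * x) (sym eq))
  ... | inj₁ p∣y*y = prime∣x*x⇒prime∣x y pp p∣y*y
  ... | inj₂ p∣v = ⊥-elim (p∤v p∣v)

  cancel-p : ∀ x y → x * x * p ≡ y * p * (y * p) * v → x * x ≡ y * y * v * p
  cancel-p x y eq = *-cancelʳ-≡ _ _ p (trans eq (reassoc y p v))
    where
    reassoc : ∀ y p v → y * p * (y * p) * v ≡ y * y * v * p * p
    reassoc = solve-∀

  cancel-p' : ∀ x y → x * p * (x * p) ≡ y * y * v * p → x * x * p ≡ y * y * v
  cancel-p' x y eq = *-cancelʳ-≡ _ _ p (trans (reassoc x p) eq)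
    where
    reassoc : ∀ x p → x * x * p * p ≡ x * p * (x * p)
    reassoc = solve-∀

  zero⊎< : ∀ x → x ≡ 0 ⊎ x < x * p
  zero⊎< zero = inj₁ refl
  zero⊎< x@(suc _) = inj₂ (m<m*n x p (nonTrivial⇒n>1 p {{prime⇒nonTrivial pp}}))

  descend : ∀ x → (∀ {x'} → x' < x → ∀ y → x' * x' * p ≡ y * y * v → x' ≡ 0)
          → ∀ y → x * x * p ≡ y * y * v → x ≡ 0
  descend x rec y eq with divides y' refl ← p∣y x y eq
    with divides x' refl ← prime∣x*x⇒prime∣x x pp (divides (y' * y' * v) (cancel-p x y' eq))
       = cong (_* p) ([ (λ x'≡0 → x'≡0)
                      , (λ x'<x → rec x'<x y' (cancel-p' x' y' (cancel-p (x' * p) y' eq))) ]′ (zero⊎< x'))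

odd-prime≤7 : Odd u → 1 < u → u ≤ 7 → Prime u
odd-prime≤7 (0 , refl) (s≤s ()) _
odd-prime≤7 (1 , refl) _ _ = from-yes (prime? 3)
odd-prime≤7 (2 , refl) _ _ = from-yes (prime? 5)
odd-prime≤7 (3 , refl) _ _ = from-yes (prime? 7)
odd-prime≤7 (suc (suc (suc (suc q))) , refl) _ u≤7 =
  ⊥-elim (<⇒≱ (s≤s (≤-trans (n≤1+n 7) (*-monoʳ-≤ 2 (m≤m+n 4 q)))) u≤7)

odd<odd≤7-descent : Odd u → u < u' → Odd u' → u' ≤ 7 → ∀ x y → x * x * u' ≡ y * y * u → x ≡ 0
odd<odd≤7-descent odd-u u<u' odd-u' u'≤7 =
  x*x*p≡y*y*v⇒x≡0 (odd-prime≤7 odd-u' (≤-trans (s≤s (Odd⇒>0 odd-u)) u<u') u'≤7)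
                   (>⇒∤ {{>-nonZero (Odd⇒>0 odd-u)}} u<u')

-- For odd u ≤ 7 the factor u is the squarefree part of w * w * u.
w*w*u-injective : Odd w → Odd w' → Odd u → Odd u' → u ≤ 7 → u' ≤ 7
                → w * w * u ≡ w' * w' * u' → u ≡ u' × w ≡ w'
w*w*u-injective {w} {w'} {u} {u'} odd-w odd-w' odd-u odd-u' u≤7 u'≤7 eq with <-cmp u u'
... | tri< u<u' _ _ = ⊥-elim (Odd⇒≢0 odd-w' (odd<odd≤7-descent odd-u u<u' odd-u' u'≤7 w' w (sym eq)))
... | tri> _ _ u'<u = ⊥-elim (Odd⇒≢0 odd-w (odd<odd≤7-descent odd-u' u'<u odd-u u≤7 w w' eq))
... | tri≈ _ refl _ = refl , m*m≡n*n⇒m≡n (*-cancelʳ-≡ _ _ u {{>-nonZero (Odd⇒>0 odd-u)}} eq)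

2^t*w*w*u-injective : ∀ {t t' w w' u u'} → Odd w → Odd w' → Odd u → Odd u' → u ≤ 7 → u' ≤ 7
                    → 2 ^ t * (w * w * u) ≡ 2 ^ t' * (w' * w' * u') → t ≡ t' × w ≡ w' × u ≡ u'
2^t*w*w*u-injective {t} {t'} odd-w odd-w' odd-u odd-u' u≤7 u'≤7 eq
  with t≡t' , core≡ ← 2^*odd-injective t t' (Odd-* (Odd-* odd-w odd-w) odd-u)
                                            (Odd-* (Odd-* odd-w' odd-w') odd-u') eq
  with u≡u' , w≡w' ← w*w*u-injective odd-w odd-w' odd-u odd-u' u≤7 u'≤7 core≡
  = t≡t' , w≡w' , u≡u'

Run : (ℕ → Set) → ℕ → ℕ → Set
Run P c d = ∀ {j} → c ≤ j → j ≤ d → P j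

record MaximalRun (P : ℕ → Set) (a b : ℕ) : Set where
  field
    a≤b   : a ≤ b
    holds : Run P a b
    ¬next : ¬ P (suc b)
    ¬prev : ∀ {c} → suc c ≡ a → ¬ P c

module _ {P : ℕ → Set} where

  Run-singleton : P a → Run P a a
  Run-singleton pa a≤j j≤a = subst P (≤-antisym a≤j j≤a) pa

  Run-++ : Run P a j → Run P (suc j) b → Run P a b
  Run-++ {j = j} left right {i} a≤i i≤b with i ≤? j
  ... | yes i≤j = left a≤i i≤j
  ... | no i≰j = right (≰⇒> i≰j) i≤b

  Run⊆MaximalRun : MaximalRun P a b → Run P c d → c ≤ b → a ≤ d → a ≤ c × d ≤ b
  Run⊆MaximalRun {a = a} {b} {c = c} {d} max run c≤b a≤d = a≤c , d≤b
    where
    open MaximalRun max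
    a≤c : a ≤ c
    a≤c with ≤-<-connex a c
    ... | inj₁ a≤c = a≤c
    ... | inj₂ c<a = ⊥-elim (prev-in-run c<a refl)
      where
      prev-in-run : ∀ {n} → c < n → n ≡ a → ⊥
      prev-in-run {suc a₀} (s≤s c≤a₀) refl = ¬prev refl (run c≤a₀ (≤-trans (n≤1+n a₀) a≤d))
    d≤b : d ≤ b
    d≤b with ≤-<-connex d b
    ... | inj₁ d≤b = d≤b
    ... | inj₂ b<d = contradiction (run (≤-trans c≤b (n≤1+n b)) b<d) ¬next

  maximalRuns-equal⊎apart : MaximalRun P a b → MaximalRun P a' b'
                          → (a ≡ a' × b ≡ b') ⊎ (2 + b ≤ a' ⊎ 2 + b' ≤ a)
  maximalRuns-equal⊎apart {a = a} {b} {a' = a'} {b'} R R' with 2 + b ≤? a' | 2 + b' ≤? a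
  ... | yes apart | _ = inj₂ (inj₁ apart)
  ... | no _ | yes apart = inj₂ (inj₂ apart)
  ... | no b+2≰a' | no b'+2≰a =
    let a≤a' , b'≤b = Run⊆MaximalRun R (MaximalRun.holds R') a'≤b a≤b'
        a'≤a , b≤b' = Run⊆MaximalRun R' (MaximalRun.holds R) a≤b' a'≤b
    in inj₁ (≤-antisym a≤a' a'≤a , ≤-antisym b≤b' b'≤b)
    where
    start≤end : ∀ {a b a' b'} → MaximalRun P a b → MaximalRun P a' b' → ¬ (2 + b ≤ a') → a' ≤ b
    start≤end R R' b+2≰a' with m≤n⇒m<n∨m≡n (≤-pred (≰⇒> b+2≰a'))
    ... | inj₁ a'<b+1 = ≤-pred a'<b+1
    ... | inj₂ refl = contradiction (MaximalRun.holds R' ≤-refl (MaximalRun.a≤b R')) (MaximalRun.¬next R)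
    a'≤b : a' ≤ b
    a'≤b = start≤end R R' b+2≰a'
    a≤b' : a ≤ b'
    a≤b' = start≤end R' R b'+2≰a

  runStart : Decidable P → P j → ∃[ a ] a ≤ j × Run P a j × (∀ {c} → suc c ≡ a → ¬ P c)
  runStart {j = zero} P? pj = 0 , z≤n , Run-singleton pj , λ ()
  runStart {j = suc j} P? psj with P? j
  ... | no ¬pj = suc j , ≤-refl , Run-singleton psj , λ { refl → ¬pj }
  ... | yes pj with a , a≤j , run , ¬prev ← runStart P? pj
    = a , m≤n⇒m≤1+n a≤j , Run-++ run (Run-singleton psj) , ¬prev

  runEnd : Decidable P → (∀ {e} → P e → e < B) → ∀ fuel → B ≤ fuel + j → P j
         → ∃[ b ] j ≤ b × Run P j b × ¬ P (suc b)
  runEnd P? bounded zero B≤j pj = ⊥-elim (<⇒≱ (bounded pj) B≤j)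
  runEnd {B = B} {j = j} P? bounded (suc fuel) B≤ pj with P? (suc j)
  ... | no ¬psj = j , ≤-refl , Run-singleton pj , ¬psj
  ... | yes psj
    with b , sj≤b , run , ¬next ← runEnd P? bounded fuel (subst (B ≤_) (sym (+-suc fuel j)) B≤) psj
    = b , <⇒≤ sj≤b , Run-++ (Run-singleton pj) run , ¬next

  maximalRun-around : Decidable P → (∀ {e} → P e → e < B) → P j
                    → ∃₂ λ a b → MaximalRun P a b × a ≤ j × j ≤ b
  maximalRun-around {B = B} {j = j} P? bounded pj
    with a , a≤j , down , ¬prev ← runStart P? pj
       | b , j≤b , up , ¬next ← runEnd P? bounded B (m≤m+n B j) pj
    = a , b , maximal , a≤j , j≤b
    where
    maximal : MaximalRun P a b
    maximal = record { a≤b = ≤-trans a≤j j≤b ; holds = Run-++ down (λ j<i → up (<⇒≤ j<i))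
                     ; ¬next = ¬next ; ¬prev = ¬prev }

≃ˢ-refl : X ≃ˢ X
≃ˢ-refl _ = (λ x∈ → x∈) , (λ x∈ → x∈)

≃ˢ-sym : X ≃ˢ Y → Y ≃ˢ X
≃ˢ-sym X≃Y x = proj₂ (X≃Y x) , proj₁ (X≃Y x)

≃ˢ-trans : X ≃ˢ Y → Y ≃ˢ T → X ≃ˢ T
≃ˢ-trans X≃Y Y≃T x = proj₁ (Y≃T x) ∘ proj₁ (X≃Y x) , proj₂ (X≃Y x) ∘ proj₂ (Y≃T x)

2^*odd>0 : ∀ e → Odd w → 0 < 2 ^ e * w
2^*odd>0 e odd = *-mono-≤ (m^n>0 2 e) (Odd⇒>0 odd)

2^i*[2^a*w]≡2^[a+i]*w : ∀ i a w → 2 ^ i * (2 ^ a * w) ≡ 2 ^ (a + i) * w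
2^i*[2^a*w]≡2^[a+i]*w i a w = begin
  2 ^ i * (2 ^ a * w) ≡⟨ *-assoc (2 ^ i) (2 ^ a) w ⟨
  2 ^ i * 2 ^ a * w   ≡⟨ cong (_* w) (*-comm (2 ^ i) (2 ^ a)) ⟩
  2 ^ a * 2 ^ i * w   ≡⟨ cong (_* w) (^-distribˡ-+-* 2 a i) ⟨
  2 ^ (a + i) * w     ∎
  where open ≡-Reasoning

∈-geo⁻ : y ∈ geo x ℓ → ∃[ i ] i < ℓ × y ≡ 2 ^ i * x
∈-geo⁻ y∈ with i , i∈ , refl ← ∈-map⁻ _ y∈ = i , ∈-upTo⁻ i∈ , refl

∈-geo⁺ : i < ℓ → 2 ^ i * x ∈ geo x ℓ
∈-geo⁺ {x = x} i<ℓ = ∈-map⁺ (λ i → 2 ^ i * x) (∈-upTo⁺ i<ℓ)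

∈-geo-2^*⁻ : y ∈ geo (2 ^ a * w) (suc m) → ∃[ j ] a ≤ j × j ≤ a + m × y ≡ 2 ^ j * w
∈-geo-2^*⁻ {a = a} {w} y∈ with i , i≤m , refl ← ∈-geo⁻ y∈ =
  a + i , m≤m+n a i , +-monoʳ-≤ a (≤-pred i≤m) , 2^i*[2^a*w]≡2^[a+i]*w i a w

∈-geo-2^*⁺ : a ≤ j → j ≤ a + m → 2 ^ j * w ∈ geo (2 ^ a * w) (suc m)
∈-geo-2^*⁺ {a} {j} {m} {w} a≤j j≤a+m =
  subst (_∈ geo (2 ^ a * w) (suc m)) shift (∈-geo⁺ (s≤s (j∸a≤m)))
  where
  shift : 2 ^ (j ∸ a) * (2 ^ a * w) ≡ 2 ^ j * w
  shift = trans (2^i*[2^a*w]≡2^[a+i]*w (j ∸ a) a w) (cong (λ n → 2 ^ n * w) (m+[n∸m]≡n a≤j))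
  j∸a≤m : j ∸ a ≤ m
  j∸a≤m = subst (j ∸ a ≤_) (m+n∸m≡n a m) (∸-monoˡ-≤ a j≤a+m)

exponents : List ℕ → ℕ → ℕ → Set
exponents T w e = 2 ^ e * w ∈ T

dyadic : ℕ → ℕ → ℕ → List ℕ
dyadic w a b = geo (2 ^ a * w) (suc (b ∸ a))

∈-dyadic⁻ : a ≤ b → y ∈ dyadic w a b → ∃[ j ] a ≤ j × j ≤ b × y ≡ 2 ^ j * w
∈-dyadic⁻ {a = a} {w = w} a≤b y∈ with j , a≤j , j≤ , refl ← ∈-geo-2^*⁻ {a = a} {w = w} y∈ =
  j , a≤j , subst (j ≤_) (m+[n∸m]≡n a≤b) j≤ , refl

∈-dyadic⁺ : a ≤ j → j ≤ b → 2 ^ j * w ∈ dyadic w a b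
∈-dyadic⁺ a≤j j≤b = ∈-geo-2^*⁺ a≤j (subst (_ ≤_) (sym (m+[n∸m]≡n (≤-trans a≤j j≤b))) j≤b)

record ChainForm (T X : List ℕ) : Set where
  field
    oddPart first last : ℕ
    odd     : Odd oddPart
    maximal : MaximalRun (exponents T oddPart) first last
    ≃dyadic : X ≃ˢ dyadic oddPart first last

0<2^i*y⇒0<y : ∀ i → 0 < 2 ^ i * y → 0 < y
0<2^i*y⇒0<y {zero} i 0<2^i*0 = ⊥-elim (<-irrefl refl (subst (0 <_) (*-zeroʳ (2 ^ i)) 0<2^i*0))
0<2^i*y⇒0<y {suc _} _ _ = z<s

geo∋2^a*w : Odd w → 2 ^ a * w ∈ geo y (suc m) → ∃[ c ] c ≤ a × a ≤ c + m × y ≡ 2 ^ c * w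
geo∋2^a*w {w} {a} {y} {m} odd a∈
  with i , i<1+m , eq ← ∈-geo⁻ a∈
  with c , w' , odd' , refl ← 2^*odd-decomposition y (0<2^i*y⇒0<y i (subst (0 <_) eq (2^*odd>0 a odd)))
  with refl , refl ← 2^*odd-injective a (c + i) odd odd' (trans eq (2^i*[2^a*w]≡2^[a+i]*w i c w'))
  = c , m≤m+n c i , +-monoʳ-≤ c (≤-pred i<1+m) , refl

maximalRun⇒IsChainA : Odd w → a < b → MaximalRun (exponents T w) a b → IsChainA T (dyadic w a b)
maximalRun⇒IsChainA {w} {a} {b} {T} odd a<b max = geoSubset , maximality
  where
  open MaximalRun max
  geoSubset : IsGeoSubset T (dyadic w a b)
  geoSubset = 2 ^ a * w , suc (b ∸ a) , s≤s (m<n⇒0<n∸m a<b) , ≃ˢ-refl , dyadic⊆T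
    where
    dyadic⊆T : dyadic w a b ⊆ˢ T
    dyadic⊆T _ y∈ with j , a≤j , j≤b , refl ← ∈-dyadic⁻ a≤b y∈ = holds a≤j j≤b
  maximality : ∀ Y → IsGeoSubset T Y → dyadic w a b ⊆ˢ Y → Y ⊆ˢ dyadic w a b
  maximality Y (y , zero , () , _)
  maximality Y (y , suc m , _ , Y≃ , Y⊆T) dyadic⊆Y
    with c , c≤a , a≤c+m , refl ← geo∋2^a*w {a = a} odd
                                    (proj₁ (Y≃ _) (dyadic⊆Y _ (∈-dyadic⁺ {w = w} ≤-refl a≤b)))
    with a≤c , c+m≤b ← Run⊆MaximalRun max
                          (λ c≤j j≤c+m → Y⊆T _ (proj₂ (Y≃ _) (∈-geo-2^*⁺ c≤j j≤c+m)))
                          (≤-trans c≤a a≤b) a≤c+m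
    = λ t t∈ → let j , c≤j , j≤c+m , t≡ = ∈-geo-2^*⁻ {a = c} {w = w} (proj₁ (Y≃ t) t∈)
               in subst (_∈ dyadic w a b) (sym t≡)
                        (∈-dyadic⁺ {w = w} (≤-trans a≤c c≤j) (≤-trans j≤c+m c+m≤b))

Positive : List ℕ → Set
Positive T = ∀ {x} → x ∈ T → 0 < x

∈⇒≤sum : x ∈ T → x ≤ sum T
∈⇒≤sum {T = t ∷ T} (here refl) = m≤m+n t (sum T)
∈⇒≤sum {T = t ∷ T} (there x∈) = ≤-trans (∈⇒≤sum x∈) (m≤n+m (sum T) t)

n<2^n : ∀ n → n < 2 ^ n
n<2^n zero = z<s
n<2^n (suc n) = +-mono-≤ (m^n>0 2 n) (≤-trans (n<2^n n) (≤-reflexive (sym (+-identityʳ (2 ^ n)))))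

exponents<sum : Odd w → exponents T w e → e < sum T
exponents<sum {w} {T} {e} odd 2^e*w∈T = begin-strict
  e         <⟨ n<2^n e ⟩
  2 ^ e     ≤⟨ m≤m*n (2 ^ e) w {{>-nonZero (Odd⇒>0 odd)}} ⟩
  2 ^ e * w ≤⟨ ∈⇒≤sum 2^e*w∈T ⟩
  sum T     ∎
  where open ≤-Reasoning

maximalExponentRun-around : Odd w → exponents T w j
                          → ∃₂ λ a b → MaximalRun (exponents T w) a b × a ≤ j × j ≤ b
maximalExponentRun-around {w} {T} odd =
  maximalRun-around (λ e → 2 ^ e * w ∈? T) (exponents<sum odd)

geoChain⇒ChainForm : Odd w → 1 ≤ m → X ≃ˢ geo (2 ^ a * w) (suc m) → X ⊆ˢ T
                   → (∀ Y → IsGeoSubset T Y → X ⊆ˢ Y → Y ⊆ˢ X) → ChainForm T X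
geoChain⇒ChainForm {w} {m} {X} {a} {T} odd 1≤m X≃ X⊆T maximalX =
  extend (maximalExponentRun-around odd (run ≤-refl (m≤m+n a m)))
  where
  run : Run (exponents T w) a (a + m)
  run a≤j j≤a+m = X⊆T _ (proj₂ (X≃ _) (∈-geo-2^*⁺ a≤j j≤a+m))
  extend : (∃₂ λ a' b' → MaximalRun (exponents T w) a' b' × a' ≤ a × a ≤ b') → ChainForm T X
  extend (a' , b' , max' , a'≤a , a≤b') = record
    { oddPart = w ; first = a' ; last = b' ; odd = odd ; maximal = max'
    ; ≃dyadic = λ x → X⊆dyadic x , dyadic⊆X x }
    where
    a+m≤b' : a + m ≤ b'
    a+m≤b' = proj₂ (Run⊆MaximalRun max' run a≤b' (≤-trans a'≤a (m≤m+n a m)))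
    a'<b' : a' < b'
    a'<b' = ≤-<-trans a'≤a (<-≤-trans (m<m+n a 1≤m) a+m≤b')
    X⊆dyadic : X ⊆ˢ dyadic w a' b'
    X⊆dyadic x x∈ =
      let j , a≤j , j≤a+m , x≡ = ∈-geo-2^*⁻ {a = a} {w = w} (proj₁ (X≃ x) x∈)
      in subst (_∈ dyadic w a' b') (sym x≡)
               (∈-dyadic⁺ {w = w} (≤-trans a'≤a a≤j) (≤-trans j≤a+m a+m≤b'))
    dyadic⊆X : dyadic w a' b' ⊆ˢ X
    dyadic⊆X = maximalX _ (proj₁ (maximalRun⇒IsChainA odd a'<b' max')) X⊆dyadic

IsChainA⇒ChainForm : Positive T → IsChainA T X → ChainForm T X
IsChainA⇒ChainForm pos ((x , zero , () , _) , _)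
IsChainA⇒ChainForm {T} {X} pos ((x , suc m , s≤s 1≤m , X≃ , X⊆T) , maximalX) =
  let a , w , odd , x≡ = 2^*odd-decomposition x (pos x∈T)
  in geoChain⇒ChainForm {a = a} odd 1≤m (subst (λ x → X ≃ˢ geo x (suc m)) x≡ X≃) X⊆T maximalX
  where
  x∈T : x ∈ T
  x∈T = subst (_∈ T) (*-identityˡ x) (X⊆T _ (proj₂ (X≃ _) (∈-geo⁺ z<s)))

singleton⇒ChainForm : Odd w → X ≃ˢ (2 ^ a * w ∷ []) → exponents T w a
                    → (∀ Y → IsChainA T Y → ¬ 2 ^ a * w ∈ Y) → ChainForm T X
singleton⇒ChainForm {w} {X} {a} {T} odd X≃ a∈ notInChainA = isolate (maximalExponentRun-around odd a∈)
  where
  isolate : (∃₂ λ a' b' → MaximalRun (exponents T w) a' b' × a' ≤ a × a ≤ b') → ChainForm T X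
  isolate (a' , b' , max' , a'≤a , a≤b') with a' <? b'
  ... | yes a'<b' =
    ⊥-elim (notInChainA _ (maximalRun⇒IsChainA odd a'<b' max') (∈-dyadic⁺ {w = w} a'≤a a≤b'))
  ... | no a'≮b' = record
    { oddPart = w ; first = a' ; last = b' ; odd = odd ; maximal = max'
    ; ≃dyadic = λ x → X⊆dyadic x , dyadic⊆X x }
    where
    b'≤a' : b' ≤ a'
    b'≤a' = ≮⇒≥ a'≮b'
    X⊆dyadic : X ⊆ˢ dyadic w a' b'
    X⊆dyadic x x∈ with proj₁ (X≃ x) x∈
    ... | here refl = ∈-dyadic⁺ {w = w} a'≤a a≤b'
    dyadic⊆X : dyadic w a' b' ⊆ˢ X
    dyadic⊆X y y∈ with j , a'≤j , j≤b' , refl ← ∈-dyadic⁻ {w = w} (MaximalRun.a≤b max') y∈ =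
      proj₂ (X≃ _) (subst (λ j → 2 ^ j * w ∈ (2 ^ a * w ∷ [])) a≡j (here refl))
      where
      a≡j : a ≡ j
      a≡j = ≤-antisym (≤-trans a≤b' (≤-trans b'≤a' a'≤j)) (≤-trans j≤b' (≤-trans b'≤a' a'≤a))

IsChainC⇒ChainForm : Positive T → IsChainC T X → ChainForm T X
IsChainC⇒ChainForm {T} {X} pos (z , X≃ , z∈T , notInChainA) =
  let a , w , odd , z≡ = 2^*odd-decomposition z (pos z∈T)
  in singleton⇒ChainForm {a = a} odd (subst (λ z → X ≃ˢ (z ∷ [])) z≡ X≃) (subst (_∈ T) z≡ z∈T)
                         (λ Y chainA → notInChainA Y chainA ∘ subst (_∈ Y) (sym z≡))

IsChain⇒ChainForm : Positive T → IsChain T X → ChainForm T X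
IsChain⇒ChainForm pos = [ IsChainA⇒ChainForm pos , IsChainC⇒ChainForm pos ]′

∈-H⁻ : x ∈ H k → 1 ≤ x × x ≤ k
∈-H⁻ x∈ with i , i∈ , refl ← ∈-map⁻ suc x∈ = s≤s z≤n , ∈-upTo⁻ i∈

∈-H⁺ : 1 ≤ x → x ≤ k → x ∈ H k
∈-H⁺ {suc i} _ i<k = ∈-map⁺ suc (∈-upTo⁺ i<k)

H-positive : Positive (H k)
H-positive x∈ = proj₁ (∈-H⁻ x∈)

∈-products⁻ : ∀ A B → m ∈ products A B → ∃₂ λ a b → a ∈ A × b ∈ B × m ≡ a * b
∈-products⁻ A B m∈
  with a , a∈ , m∈aB ← find (∈-concatMap⁻ (λ a → map (a *_) B) {xs = A} m∈)
  with b , b∈ , refl ← ∈-map⁻ (a *_) m∈aB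
  = a , b , a∈ , b∈ , refl

∈-∇⁻ : ∀ A B → m ∈ A ∇ B → ∃₂ λ a b → a ∈ A × b ∈ B × m ≡ a * b
∈-∇⁻ A B m∈
  with a , b , a∈ , b∈ , refl ← ∈-products⁻ (deduplicate _≟_ A) (deduplicate _≟_ B)
                                  (proj₁ (∈-filter⁻ _ (∈-deduplicate⁻ _≟_ _ m∈)))
  = a , b , ∈-deduplicate⁻ _≟_ A a∈ , ∈-deduplicate⁻ _≟_ B b∈ , refl

∇-positive : ∀ {A B} → Positive A → Positive B → Positive (A ∇ B)
∇-positive {A} {B} posA posB m∈ with a , b , a∈ , b∈ , refl ← ∈-∇⁻ A B m∈ =
  *-mono-≤ (posA a∈) (posB b∈)

Hpow-positive : ∀ k n → Positive (Hpow k n)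
Hpow-positive k zero (here refl) = z<s
Hpow-positive k (suc n) = ∇-positive (Hpow-positive k n) H-positive

∈-chain⁻ : (R : ChainForm T X) → x ∈ X
         → ∃[ j ] ChainForm.first R ≤ j × j ≤ ChainForm.last R × x ≡ 2 ^ j * ChainForm.oddPart R
∈-chain⁻ {x = x} R x∈ = ∈-dyadic⁻ {w = oddPart} a≤b (proj₁ (≃dyadic x) x∈)
  where
  open ChainForm R
  open MaximalRun maximal

H-chain-first≡0 : (S : ChainForm (H k) Y) → ChainForm.first S ≡ 0
H-chain-first≡0 {k} S = start≡0 first refl
  where
  open ChainForm S
  open MaximalRun maximal
  2^first*w≤k : 2 ^ first * oddPart ≤ k
  2^first*w≤k = proj₂ (∈-H⁻ (holds ≤-refl a≤b))
  start≡0 : ∀ n → n ≡ first → n ≡ 0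
  start≡0 zero _ = refl
  start≡0 (suc c) c+1≡first = ⊥-elim (¬prev c+1≡first (∈-H⁺ (2^*odd>0 c odd) 2^c*w≤k))
    where
    2^c*w≤k : 2 ^ c * oddPart ≤ k
    2^c*w≤k = ≤-trans (*-monoˡ-≤ oddPart (^-monoʳ-≤ 2 (n≤1+n c)))
                      (subst (λ n → 2 ^ n * oddPart ≤ k) (sym c+1≡first) 2^first*w≤k)

H≤7-chain-bounds : k ≤ 7 → (S : ChainForm (H k) Y) → ChainForm.oddPart S ≤ 7 × ChainForm.last S ≤ 2
H≤7-chain-bounds {k} k≤7 S = w≤7 , ≮⇒≥ 2≮last
  where
  open ChainForm S
  open MaximalRun maximal
  instance
    w≢0 : NonZero oddPart
    w≢0 = >-nonZero (Odd⇒>0 odd)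
  2^last*w≤7 : 2 ^ last * oddPart ≤ 7
  2^last*w≤7 = ≤-trans (proj₂ (∈-H⁻ (holds a≤b ≤-refl))) k≤7
  w≤7 : oddPart ≤ 7
  w≤7 = ≤-trans (m≤n*m oddPart (2 ^ last) {{m^n≢0 2 last}}) 2^last*w≤7
  2≮last : ¬ 2 < last
  2≮last 2<last = 1+n≰n (≤-trans (^-monoʳ-≤ 2 2<last) (≤-trans (m≤m*n (2 ^ last) oddPart) 2^last*w≤7))

2^j*w*[2^j'*w]*[2^e*u] : ∀ j j' e w u → 2 ^ j * w * (2 ^ j' * w) * (2 ^ e * u) ≡ 2 ^ (j + j' + e) * (w * w * u)
2^j*w*[2^j'*w]*[2^e*u] j j' e w u = begin
  2 ^ j * w * (2 ^ j' * w) * (2 ^ e * u) ≡⟨ regroup (2 ^ j) (2 ^ j') (2 ^ e) w u ⟩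
  2 ^ j * 2 ^ j' * 2 ^ e * (w * w * u)   ≡⟨ cong (λ p → p * 2 ^ e * (w * w * u)) (^-distribˡ-+-* 2 j j') ⟨
  2 ^ (j + j') * 2 ^ e * (w * w * u)     ≡⟨ cong (_* (w * w * u)) (^-distribˡ-+-* 2 (j + j') e) ⟨
  2 ^ (j + j' + e) * (w * w * u)         ∎
  where
  open ≡-Reasoning
  regroup : ∀ A B C w u → A * w * (B * w) * (C * u) ≡ A * B * C * (w * w * u)
  regroup = solve-∀

∈-sq∇∇⁻ : ∀ {T T' C D} (R : ChainForm T C) (S : ChainForm T' D) → m ∈ sq∇ C ∇ D
        → let open ChainForm in
          ∃[ t ] first R + first R + first S ≤ t × t ≤ last R + last R + last S
                 × m ≡ 2 ^ t * (oddPart R * oddPart R * oddPart S)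
∈-sq∇∇⁻ {C = C} {D} R S m∈
  with s , d , s∈ , d∈ , refl ← ∈-∇⁻ (sq∇ C) D m∈
  with c , c' , c∈ , c'∈ , refl ← ∈-∇⁻ C C s∈
  with j , a≤j , j≤b , refl ← ∈-chain⁻ R c∈
  with j' , a≤j' , j'≤b , refl ← ∈-chain⁻ R c'∈
  with e , a≤e , e≤b , refl ← ∈-chain⁻ S d∈
  = j + j' + e , +-mono-≤ (+-mono-≤ a≤j a≤j') a≤e , +-mono-≤ (+-mono-≤ j≤b j'≤b) e≤b
  , 2^j*w*[2^j'*w]*[2^e*u] j j' e (ChainForm.oddPart R) (ChainForm.oddPart S)

ChainForms-≃⊎apart : (R : ChainForm T X) (S : ChainForm T Y) → ChainForm.oddPart R ≡ ChainForm.oddPart S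
                   → let open ChainForm in
                     X ≃ˢ Y ⊎ (2 + last R ≤ first S ⊎ 2 + last S ≤ first R)
ChainForms-≃⊎apart record { oddPart = w ; first = a ; last = b ; maximal = maxR ; ≃dyadic = X≃ }
                   record { oddPart = .w ; first = a' ; last = b' ; maximal = maxS ; ≃dyadic = Y≃ } refl
  with maximalRuns-equal⊎apart maxR maxS
... | inj₁ (refl , refl) = inj₁ (≃ˢ-trans X≃ (≃ˢ-sym Y≃))
... | inj₂ apart = inj₂ apart

exponent-gap : ∀ {a b e f t t'} → 2 + b ≤ a → t ≤ b + b + e → e ≤ 2 → a + a + f ≤ t' → t' ≤ suc t → ⊥
exponent-gap {a} {b} {e} {f} {t} {t'} gap t≤ e≤2 a+a+f≤t' t'≤1+t = 1+n≰n (begin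
  suc (suc (b + b + 2)) ≡⟨ rearrange b ⟩
  (2 + b) + (2 + b)     ≤⟨ +-mono-≤ gap gap ⟩
  a + a                 ≤⟨ m≤m+n (a + a) f ⟩
  a + a + f             ≤⟨ a+a+f≤t' ⟩
  t'                    ≤⟨ t'≤1+t ⟩
  suc t                 ≤⟨ s≤s t≤ ⟩
  suc (b + b + e)       ≤⟨ s≤s (+-monoʳ-≤ (b + b) e≤2) ⟩
  suc (b + b + 2)       ∎)
  where
  open ≤-Reasoning
  rearrange : ∀ b → suc (suc (b + b + 2)) ≡ (2 + b) + (2 + b)
  rearrange = solve-∀

sq∇∇-disjoint-scaled : ∀ {T C₁ C₂ D₁ D₂} → k ≤ 7 → ChainForm T C₁ → ChainForm T C₂
                     → ChainForm (H k) D₁ → ChainForm (H k) D₂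
                     → (¬ C₁ ≃ˢ C₂) ⊎ (¬ D₁ ≃ˢ D₂) → i ≤ 1
                     → Disjoint (sq∇ C₁ ∇ D₁) (scale (2 ^ i) (sq∇ C₂ ∇ D₂))
sq∇∇-disjoint-scaled {i = i} {C₁ = C₁} {C₂} {D₁} {D₂} k≤7 R₁ R₂ S₁ S₂ distinct i≤1
                     m m∈ m∈scaled
  with m' , m'∈ , refl ← ∈-map⁻ (2 ^ i *_) m∈scaled
  with t₁ , lo₁ , hi₁ , m≡ ← ∈-sq∇∇⁻ R₁ S₁ m∈
  with t₂ , lo₂ , hi₂ , refl ← ∈-sq∇∇⁻ R₂ S₂ m'∈
  with u₁≤7 , last-S₁≤2 ← H≤7-chain-bounds k≤7 S₁
  with u₂≤7 , last-S₂≤2 ← H≤7-chain-bounds k≤7 S₂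
  with t₁≡t₂+i , w₁≡w₂ , u₁≡u₂ ← 2^t*w*w*u-injective (ChainForm.odd R₁) (ChainForm.odd R₂)
                                   (ChainForm.odd S₁) (ChainForm.odd S₂) u₁≤7 u₂≤7
                                   (trans (sym m≡) (2^i*[2^a*w]≡2^[a+i]*w i t₂ _))
  = [ C-distinct , D-distinct ]′ distinct
  where
  open ChainForm
  t₂≤1+t₁ : t₂ ≤ suc t₁
  t₂≤1+t₁ = ≤-trans (m≤m+n t₂ i) (≤-trans (≤-reflexive (sym t₁≡t₂+i)) (n≤1+n t₁))
  t₁≤1+t₂ : t₁ ≤ suc t₂
  t₁≤1+t₂ = begin
    t₁     ≡⟨ t₁≡t₂+i ⟩
    t₂ + i ≤⟨ +-monoʳ-≤ t₂ i≤1 ⟩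
    t₂ + 1 ≡⟨ +-comm t₂ 1 ⟩
    suc t₂ ∎
    where open ≤-Reasoning
  D-distinct : ¬ ¬ D₁ ≃ˢ D₂
  D-distinct ¬D₁≃D₂ with ChainForms-≃⊎apart S₁ S₂ u₁≡u₂
  ... | inj₁ D₁≃D₂ = ¬D₁≃D₂ D₁≃D₂
  ... | inj₂ (inj₁ gap) = n≮0 (subst (2 + last S₁ ≤_) (H-chain-first≡0 S₂) gap)
  ... | inj₂ (inj₂ gap) = n≮0 (subst (2 + last S₂ ≤_) (H-chain-first≡0 S₁) gap)
  C-distinct : ¬ ¬ C₁ ≃ˢ C₂
  C-distinct ¬C₁≃C₂ with ChainForms-≃⊎apart R₁ R₂ w₁≡w₂
  ... | inj₁ C₁≃C₂ = ¬C₁≃C₂ C₁≃C₂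
  ... | inj₂ (inj₁ gap) = exponent-gap gap hi₁ last-S₁≤2 lo₂ t₂≤1+t₁
  ... | inj₂ (inj₂ gap) = exponent-gap gap hi₂ last-S₂≤2 lo₁ t₁≤1+t₂

proposition7 : (k : ℕ) → 4 ≤ k → k ≤ 7 → (n : ℕ)
    → (C₁ C₂ D₁ D₂ : List ℕ)
    → IsChain (Hpow k (2 ^ n ∸ 1)) C₁ → IsChain (Hpow k (2 ^ n ∸ 1)) C₂
    → IsChain (H k) D₁ → IsChain (H k) D₂
    → (¬ (C₁ ≃ˢ C₂)) ⊎ (¬ (D₁ ≃ˢ D₂))
    → (i : ℕ) → i ≤ 1
    → Disjoint (sq∇ C₁ ∇ D₁) (scale (2 ^ i) (sq∇ C₂ ∇ D₂))
      × Disjoint (sq∇ C₂ ∇ D₂) (scale (2 ^ i) (sq∇ C₁ ∇ D₁))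
proposition7 k _ k≤7 n C₁ C₂ D₁ D₂ c₁ c₂ d₁ d₂ distinct i i≤1 =
  sq∇∇-disjoint-scaled k≤7 R₁ R₂ S₁ S₂ distinct i≤1 ,
  sq∇∇-disjoint-scaled k≤7 R₂ R₁ S₂ S₁ (⊎-map (_∘ ≃ˢ-sym) (_∘ ≃ˢ-sym) distinct) i≤1
  where
  R₁ : ChainForm (Hpow k (2 ^ n ∸ 1)) C₁
  R₁ = IsChain⇒ChainForm (Hpow-positive k (2 ^ n ∸ 1)) c₁
  R₂ : ChainForm (Hpow k (2 ^ n ∸ 1)) C₂
  R₂ = IsChain⇒ChainForm (Hpow-positive k (2 ^ n ∸ 1)) c₂
  S₁ : ChainForm (H k) D₁
  S₁ = IsChain⇒ChainForm H-positive d₁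
  S₂ : ChainForm (H k) D₂
  S₂ = IsChain⇒ChainForm H-positive d₂
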